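{- Let $\mathcal M$ be a structure and $X,Y,Z$ definable sets. Suppose that for every positive integer $n$, every definable subset of $X^n\times Y$ is a finite union of $(X^n,Y)$-boxes, and every definable subset of $X^n\times Z$ is a finite union of $(X^n,Z)$-boxes. Then for every $n$, every definable subset of $X^n\times Y\times Z$ is a finite union of $(X^n,Y\times Z)$-boxes.
   Context: "Definable" means definable in $\mathcal M$ with parameters. For definable sets $Y_1,\ldots,Y_k$, a $(Y_1,\ldots,Y_k)$-box is a definable set of the form $U_1\times\cdots\times U_k$ with $U_i\subseteq Y_i$ for each $i$. -}

module Defs where

open import Data.Nat using (ℕ; zero; suc; _+_; _*_)
open import Data.Fin using (Fin)
open import Data.Vec using (Vec; []; _∷_; lookup; take; drop)
open import Data.Product using (Σ; _×_; _,_)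
open import Data.Sum using (_⊎_)
open import Data.Unit using (⊤)
open import Data.Empty using (⊥)
open import Data.List using (List)
open import Data.List.Relation.Unary.Any using (Any)
open import Relation.Binary.PropositionalEquality using (_≡_)
open import Relation.Nullary using (¬_)
open import Function.Bundles using (_⇔_)

record Language : Set₁ where
  field
    Func : ℕ → Set   -- function symbols of each arity (constants: arity 0)
    Rel  : ℕ → Set

open Language public

record Structure (L : Language) : Set₁ where
  field
    Carrier : Set
    funᴹ    : ∀ {k} → Func L k → Vec Carrier k → Carrier
    relᴹ    : ∀ {k} → Rel L k → Vec Carrier k → Set

open Structure public

module Syntax (L : Language) (P : Set) where

  data Term (n : ℕ) : Set where
    var : Fin n → Term n
    par : P → Term n
    app : ∀ {k} → Func L k → Vec (Term n) k → Term n

  data Formula (n : ℕ) : Set where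
    ⊤f ⊥f       : Formula n
    _≐_         : Term n → Term n → Formula n
    rel         : ∀ {k} → Rel L k → Vec (Term n) k → Formula n
    ¬f_         : Formula n → Formula n
    _∧f_ _∨f_ _⇒f_ : Formula n → Formula n → Formula n
    ∃f ∀f       : Formula (suc n) → Formula n

module Semantics {L : Language} (𝓜 : Structure L) where

  open Syntax L (Carrier 𝓜) public

  M : Set
  M = Carrier 𝓜

  mutual
    eval : ∀ {n} → Term n → Vec M n → M
    eval (var i)    ρ = lookup ρ i
    eval (par m)    ρ = m
    eval (app f ts) ρ = funᴹ 𝓜 f (evalVec ts ρ)

    evalVec : ∀ {n k} → Vec (Term n) k → Vec M n → Vec M k
    evalVec []       ρ = []
    evalVec (t ∷ ts) ρ = eval t ρ ∷ evalVec ts ρ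

  Sat : ∀ {n} → Formula n → Vec M n → Set
  Sat ⊤f         ρ = ⊤
  Sat ⊥f         ρ = ⊥
  Sat (s ≐ t)    ρ = eval s ρ ≡ eval t ρ
  Sat (rel R ts) ρ = relᴹ 𝓜 R (evalVec ts ρ)
  Sat (¬f φ)     ρ = ¬ Sat φ ρ
  Sat (φ ∧f ψ)   ρ = Sat φ ρ × Sat ψ ρ
  Sat (φ ∨f ψ)   ρ = Sat φ ρ ⊎ Sat ψ ρ
  Sat (φ ⇒f ψ)   ρ = Sat φ ρ → Sat ψ ρ
  Sat (∃f φ)     ρ = Σ M λ m → Sat φ (m ∷ ρ)
  Sat (∀f φ)     ρ = (m : M) → Sat φ (m ∷ ρ)

  -- Definable (with parameters) subsets of M^k are given by formulas
  -- with k free variables and parameters from M.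

  Definable : ℕ → Set
  Definable k = Formula k

  _∈_ : ∀ {k} → Vec M k → Definable k → Set
  v ∈ A = Sat A v

  _⊆_ : ∀ {k} → Definable k → Definable k → Set
  A ⊆ B = ∀ v → v ∈ A → v ∈ B

  _∈×_ : ∀ {a b} → Vec M (a + b) → Definable a × Definable b → Set
  _∈×_ {a} v (A , B) = take a v ∈ A × drop a v ∈ B

  InPow : ∀ {a} → Definable a → (n : ℕ) → Vec M (n * a) → Set
  InPow X zero    v = ⊤
  InPow {a} X (suc n) v = take a v ∈ X × InPow X n (drop a v)

  -- Boxes and finite unions of boxes.
  -- An (S,T)-box, for S ⊆ M^p and T ⊆ M^q, is a set U × V with U ⊆ S,
  -- V ⊆ T definable.  We describe S and T by their membership predicates.

  record Box {p q : ℕ} (S : Vec M p → Set) (T : Vec M q → Set) : Set where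
    field
      U    : Definable p
      V    : Definable q
      U⊆S  : ∀ v → v ∈ U → S v
      V⊆T  : ∀ v → v ∈ V → T v

  _∈Box_ : ∀ {p q} {S : Vec M p → Set} {T : Vec M q → Set} →
           Vec M (p + q) → Box S T → Set
  v ∈Box b = v ∈× (Box.U b , Box.V b)

  FiniteUnionOfBoxes : ∀ {p q} (S : Vec M p → Set) (T : Vec M q → Set) →
                       Definable (p + q) → Set
  FiniteUnionOfBoxes S T D =
    Σ (List (Box S T)) λ bs → ∀ v → (v ∈ D) ⇔ Any (λ b → v ∈Box b) bs

  SubsetOf× : ∀ {p q} (S : Vec M p → Set) (T : Vec M q → Set) →
              Definable (p + q) → Set
  SubsetOf× {p} S T D = ∀ v → v ∈ D → S (take p v) × T (drop p v)

  BoxDecomposable : ∀ {p q} (S : Vec M p → Set) (T : Vec M q → Set) → Set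
  BoxDecomposable {p} {q} S T =
    (D : Definable (p + q)) → SubsetOf× S T D → FiniteUnionOfBoxes S T D

module Submission where

-- Let π ⊆ X^(n+1) be the projection of D ⊆ X^(n+1) × Y × Z.  For y ∈ Y the fibre
-- {(x, z) : (x, y, z) ∈ D} is a finite union of boxes, so points x, x′ ∈ π that no X-side
-- of these boxes separates satisfy D(x, y, -) = D(x′, y, -).  The relation
-- E(x, x′, y) :⇔ x, x′ ∈ π and D(x, y, -) = D(x′, y, -) is a definable subset of
-- X^(2n+2) × Y, hence a finite union of boxes.  Classically, pick for each of the finitely
-- many ways of lying in their Y-sides one representative y′ ∈ Y; every Y-side containing y′
-- contains y, so E(x, x′, y′) implies E(x, x′, y).  Hence the finitely many X-sides of the
-- boxes of the fibres over the representatives determine the section D(x, -), and D is the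
-- union, over the atoms A of the Boolean algebra they generate, of the boxes
-- (A ∩ π) × {w : ∃ x ∈ A. (x, w) ∈ D}.

open import Defs
open import Axiom.ExcludedMiddle using (ExcludedMiddle)
open import Level using (0ℓ)
open import Data.Nat using (ℕ; zero; suc; pred; _+_; _*_)
open import Data.Nat.Properties using (*-distribʳ-+)
open import Data.Fin using (Fin; zero; suc)
open import Data.Product using (Σ; _×_; _,_; proj₁; proj₂)
open import Data.Product.Function.NonDependent.Propositional using (_×-⇔_)
open import Data.Product.Function.Dependent.Propositional using (Σ-⇔)
open import Data.Sum.Function.Propositional using (_⊎-⇔_)
open import Data.Empty using (⊥-elim)
open import Data.Unit using (tt)
open import Data.List using (List; []; _∷_; concatMap) renaming (map to mapᴸ; _++_ to _++ᴸ_)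
open import Data.List.Relation.Unary.Any using (Any; here; there)
import Data.List.Relation.Unary.Any as Any
import Data.List.Relation.Unary.Any.Properties as Anyₚ
open import Data.List.Relation.Unary.All using (All; []; _∷_)
import Data.List.Relation.Unary.All as All
import Data.List.Relation.Unary.All.Properties as Allₚ
open import Relation.Nullary using (¬_; yes; no)
open import Data.Vec using (Vec; []; _∷_; lookup; take; drop; _++_; cast)
open import Data.Vec.Properties using (take++drop≡id; ++-injectiveˡ; ++-injectiveʳ)
open import Data.Vec.Relation.Binary.Equality.Cast using (cast-is-id)
open import Function using (_∘_)
open import Function.Bundles using (_⇔_; mk⇔; Equivalence)
open import Function.Construct.Identity using (↠-id)
open import Function.Properties.Equivalence using (⇔-isEquivalence)
open import Function.Related.TypeIsomorphisms using (→-cong-⇔; ¬-cong-⇔)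
open import Relation.Binary.Structures using (IsEquivalence)
open import Relation.Binary.PropositionalEquality using (_≡_; refl; sym; trans; cong; cong₂; subst)

open IsEquivalence (⇔-isEquivalence {0ℓ}) using ()
  renaming (refl to ⇔-refl; trans to ⇔-trans; reflexive to ≡⇒⇔)

Π-⇔ : {I : Set} {A B : I → Set} → (∀ i → A i ⇔ B i) → ((i : I) → A i) ⇔ ((i : I) → B i)
Π-⇔ A⇔B = mk⇔ (λ f i → Equivalence.to (A⇔B i) (f i)) (λ f i → Equivalence.from (A⇔B i) (f i))

Any-mp : {A : Set} {P Q : A → Set} {xs : List A} → All (λ x → P x → Q x) xs → Any P xs → Any Q xs
Any-mp (f ∷ _)  (here p)  = here (f p)
Any-mp (_ ∷ fs) (there p) = there (Any-mp fs p)

module _ {A : Set} where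

  take-++ : ∀ {m n} (xs : Vec A m) (ys : Vec A n) → take m (xs ++ ys) ≡ xs
  take-++ {m} xs ys = ++-injectiveˡ (take m (xs ++ ys)) xs (take++drop≡id m (xs ++ ys))

  drop-++ : ∀ {m n} (xs : Vec A m) (ys : Vec A n) → drop m (xs ++ ys) ≡ ys
  drop-++ {m} xs ys = ++-injectiveʳ (take m (xs ++ ys)) xs (take++drop≡id m (xs ++ ys))

  cast-++-assoc : ∀ {k l l′ j} (xs : Vec A k) (ys : Vec A l) (zs : Vec A l′)
                  .(e : (k + l) + l′ ≡ k + j) .(e′ : l + l′ ≡ j) →
                  cast e ((xs ++ ys) ++ zs) ≡ xs ++ cast e′ (ys ++ zs)
  cast-++-assoc []       ys zs e e′ = refl
  cast-++-assoc (x ∷ xs) ys zs e e′ = cong (x ∷_) (cast-++-assoc xs ys zs (cong pred e) e′)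

  subst-pred : ∀ {m n} (e : m ≡ n) (S : Vec A m → Set) (u : Vec A n) →
               S (cast (sym e) u) → subst (λ k → Vec A k → Set) e S u
  subst-pred refl S u = subst S (cast-is-id refl u)

module Definability {L : Language} (𝓜 : Structure L) where
  open Semantics 𝓜

  private variable
    j j′ k k′ : ℕ

  mutual
    weaken : Term k → Term (suc k)
    weaken (var i)    = var (suc i)
    weaken (par m)    = par m
    weaken (app f ts) = app f (weakenAll ts)

    weakenAll : Vec (Term k) j → Vec (Term (suc k)) j
    weakenAll []       = []
    weakenAll (t ∷ ts) = weaken t ∷ weakenAll ts

  mutual
    eval-weaken : (t : Term k) (m : M) (ρ : Vec M k) → eval (weaken t) (m ∷ ρ) ≡ eval t ρ
    eval-weaken (var i)    m ρ = refl
    eval-weaken (par _)    m ρ = refl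
    eval-weaken (app f ts) m ρ = cong (funᴹ 𝓜 f) (evalVec-weakenAll ts m ρ)

    evalVec-weakenAll : (ts : Vec (Term k) j) (m : M) (ρ : Vec M k) →
                        evalVec (weakenAll ts) (m ∷ ρ) ≡ evalVec ts ρ
    evalVec-weakenAll []       m ρ = refl
    evalVec-weakenAll (t ∷ ts) m ρ = cong₂ _∷_ (eval-weaken t m ρ) (evalVec-weakenAll ts m ρ)

  infix 25 _[_]ᵗ _[_]ᵗˢ _[_]

  mutual
    _[_]ᵗ : Term k → Vec (Term k′) k → Term k′
    var i    [ σ ]ᵗ = lookup σ i
    par m    [ σ ]ᵗ = par m
    app f ts [ σ ]ᵗ = app f (ts [ σ ]ᵗˢ)

    _[_]ᵗˢ : Vec (Term k) j → Vec (Term k′) k → Vec (Term k′) j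
    []       [ σ ]ᵗˢ = []
    (t ∷ ts) [ σ ]ᵗˢ = t [ σ ]ᵗ ∷ ts [ σ ]ᵗˢ

  eval-lookup : (σ : Vec (Term k′) k) (i : Fin k) (ρ : Vec M k′) →
                eval (lookup σ i) ρ ≡ lookup (evalVec σ ρ) i
  eval-lookup (t ∷ σ) zero    ρ = refl
  eval-lookup (t ∷ σ) (suc i) ρ = eval-lookup σ i ρ

  mutual
    eval-[]ᵗ : (t : Term k) (σ : Vec (Term k′) k) (ρ : Vec M k′) →
               eval (t [ σ ]ᵗ) ρ ≡ eval t (evalVec σ ρ)
    eval-[]ᵗ (var i)    σ ρ = eval-lookup σ i ρ
    eval-[]ᵗ (par m)    σ ρ = refl
    eval-[]ᵗ (app f ts) σ ρ = cong (funᴹ 𝓜 f) (evalVec-[]ᵗˢ ts σ ρ)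

    evalVec-[]ᵗˢ : (ts : Vec (Term k) j) (σ : Vec (Term k′) k) (ρ : Vec M k′) →
                   evalVec (ts [ σ ]ᵗˢ) ρ ≡ evalVec ts (evalVec σ ρ)
    evalVec-[]ᵗˢ []       σ ρ = refl
    evalVec-[]ᵗˢ (t ∷ ts) σ ρ = cong₂ _∷_ (eval-[]ᵗ t σ ρ) (evalVec-[]ᵗˢ ts σ ρ)

  liftₛ : Vec (Term k′) k → Vec (Term (suc k′)) (suc k)
  liftₛ σ = var zero ∷ weakenAll σ

  _[_] : Formula k → Vec (Term k′) k → Formula k′
  ⊤f       [ σ ] = ⊤f
  ⊥f       [ σ ] = ⊥f
  (s ≐ t)  [ σ ] = s [ σ ]ᵗ ≐ t [ σ ]ᵗ
  rel R ts [ σ ] = rel R (ts [ σ ]ᵗˢ)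
  (¬f φ)   [ σ ] = ¬f (φ [ σ ])
  (φ ∧f ψ) [ σ ] = φ [ σ ] ∧f ψ [ σ ]
  (φ ∨f ψ) [ σ ] = φ [ σ ] ∨f ψ [ σ ]
  (φ ⇒f ψ) [ σ ] = φ [ σ ] ⇒f ψ [ σ ]
  ∃f φ     [ σ ] = ∃f (φ [ liftₛ σ ])
  ∀f φ     [ σ ] = ∀f (φ [ liftₛ σ ])

  mutual
    Sat-[] : (φ : Formula k) (σ : Vec (Term k′) k) (ρ : Vec M k′) →
             Sat (φ [ σ ]) ρ ⇔ Sat φ (evalVec σ ρ)
    Sat-[] ⊤f         σ ρ = ⇔-refl
    Sat-[] ⊥f         σ ρ = ⇔-refl
    Sat-[] (s ≐ t)    σ ρ = ≡⇒⇔ (cong₂ _≡_ (eval-[]ᵗ s σ ρ) (eval-[]ᵗ t σ ρ))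
    Sat-[] (rel R ts) σ ρ = ≡⇒⇔ (cong (relᴹ 𝓜 R) (evalVec-[]ᵗˢ ts σ ρ))
    Sat-[] (¬f φ)     σ ρ = ¬-cong-⇔ (Sat-[] φ σ ρ)
    Sat-[] (φ ∧f ψ)   σ ρ = Sat-[] φ σ ρ ×-⇔ Sat-[] ψ σ ρ
    Sat-[] (φ ∨f ψ)   σ ρ = Sat-[] φ σ ρ ⊎-⇔ Sat-[] ψ σ ρ
    Sat-[] (φ ⇒f ψ)   σ ρ = →-cong-⇔ (Sat-[] φ σ ρ) (Sat-[] ψ σ ρ)
    Sat-[] (∃f φ)     σ ρ = Σ-⇔ (↠-id _) (Sat-[]-lift φ σ ρ _)
    Sat-[] (∀f φ)     σ ρ = Π-⇔ (Sat-[]-lift φ σ ρ)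

    Sat-[]-lift : (φ : Formula (suc k)) (σ : Vec (Term k′) k) (ρ : Vec M k′) (m : M) →
                  Sat (φ [ liftₛ σ ]) (m ∷ ρ) ⇔ Sat φ (m ∷ evalVec σ ρ)
    Sat-[]-lift φ σ ρ m =
      ⇔-trans (Sat-[] φ (liftₛ σ) (m ∷ ρ))
              (≡⇒⇔ (cong (λ ρ′ → Sat φ (m ∷ ρ′)) (evalVec-weakenAll σ m ρ)))

  evalVec-++ : (ts : Vec (Term k) j) (ss : Vec (Term k) j′) (ρ : Vec M k) →
               evalVec (ts ++ ss) ρ ≡ evalVec ts ρ ++ evalVec ss ρ
  evalVec-++ []       ss ρ = refl
  evalVec-++ (t ∷ ts) ss ρ = cong (eval t ρ ∷_) (evalVec-++ ts ss ρ)

  record DefinableMap (k j : ℕ) (f : Vec M k → Vec M j) : Set where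
    field
      terms      : Vec (Term k) j
      eval-terms : ∀ ρ → evalVec terms ρ ≡ f ρ

  open DefinableMap

  idᵐ : ∀ k → DefinableMap k k (λ ρ → ρ)
  idᵐ zero    = record { terms = [] ; eval-terms = λ { [] → refl } }
  idᵐ (suc k) = record
    { terms      = var zero ∷ weakenAll (terms (idᵐ k))
    ; eval-terms = λ { (m ∷ ρ) → cong (m ∷_) (trans (evalVec-weakenAll _ m ρ) (eval-terms (idᵐ k) ρ)) } }

  takeᵐ : ∀ p {q} → DefinableMap (p + q) p (take p)
  takeᵐ zero    = record { terms = [] ; eval-terms = λ _ → refl }
  takeᵐ (suc p) = record
    { terms      = var zero ∷ weakenAll (terms (takeᵐ p))
    ; eval-terms = λ { (m ∷ ρ) → cong (m ∷_) (trans (evalVec-weakenAll _ m ρ) (eval-terms (takeᵐ p) ρ)) } }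

  dropᵐ : ∀ p {q} → DefinableMap (p + q) q (drop p)
  dropᵐ zero    = idᵐ _
  dropᵐ (suc p) = record
    { terms      = weakenAll (terms (dropᵐ p))
    ; eval-terms = λ { (m ∷ ρ) → trans (evalVec-weakenAll _ m ρ) (eval-terms (dropᵐ p) ρ) } }

  constᵐ : (y : Vec M j) → DefinableMap k j (λ _ → y)
  constᵐ []       = record { terms = [] ; eval-terms = λ _ → refl }
  constᵐ (y ∷ ys) = record
    { terms      = par y ∷ terms (constᵐ ys)
    ; eval-terms = λ ρ → cong (y ∷_) (eval-terms (constᵐ ys) ρ) }

  infixr 5 _++ᵐ_
  infixr 9 _∘ᵐ_

  _++ᵐ_ : ∀ {f : Vec M k → Vec M j} {g : Vec M k → Vec M j′} →
          DefinableMap k j f → DefinableMap k j′ g → DefinableMap k (j + j′) (λ ρ → f ρ ++ g ρ)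
  F ++ᵐ G = record
    { terms      = terms F ++ terms G
    ; eval-terms = λ ρ → trans (evalVec-++ (terms F) (terms G) ρ) (cong₂ _++_ (eval-terms F ρ) (eval-terms G ρ)) }

  _∘ᵐ_ : ∀ {f : Vec M k′ → Vec M j} {g : Vec M k → Vec M k′} →
         DefinableMap k′ j f → DefinableMap k k′ g → DefinableMap k j (f ∘ g)
  F ∘ᵐ G = record
    { terms      = terms F [ terms G ]ᵗˢ
    ; eval-terms = λ ρ → trans (evalVec-[]ᵗˢ (terms F) (terms G) ρ)
                               (trans (cong (evalVec (terms F)) (eval-terms G ρ)) (eval-terms F _)) }

  record IsDefinable (P : Vec M k → Set) : Set where
    field
      formula : Formula k
      defines : ∀ v → v ∈ formula ⇔ P v

  open IsDefinable

  ∈-isDefinable : (φ : Formula k) → IsDefinable (_∈ φ)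
  ∈-isDefinable φ = record { formula = φ ; defines = λ _ → ⇔-refl }

  ∘-isDefinable : ∀ {f : Vec M k → Vec M j} {P : Vec M j → Set} →
                  DefinableMap k j f → IsDefinable P → IsDefinable (P ∘ f)
  ∘-isDefinable {f = f} F D = record
    { formula = formula D [ terms F ]
    ; defines = λ ρ → ⇔-trans (Sat-[] (formula D) (terms F) ρ)
                        (⇔-trans (≡⇒⇔ (cong (Sat (formula D)) (eval-terms F ρ))) (defines D (f ρ))) }

  ×-isDefinable : ∀ {P Q : Vec M k → Set} → IsDefinable P → IsDefinable Q → IsDefinable (λ v → P v × Q v)
  ×-isDefinable D E = record
    { formula = formula D ∧f formula E
    ; defines = λ v → defines D v ×-⇔ defines E v }

  ⇔-isDefinable : ∀ {P Q : Vec M k → Set} → IsDefinable P → IsDefinable Q → IsDefinable (λ v → P v ⇔ Q v)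
  ⇔-isDefinable D E = record
    { formula = (formula D ⇒f formula E) ∧f (formula E ⇒f formula D)
    ; defines = λ v → ⇔-trans (→-cong-⇔ (defines D v) (defines E v) ×-⇔ →-cong-⇔ (defines E v) (defines D v))
                              (mk⇔ (λ (f , g) → mk⇔ f g) (λ e → Equivalence.to e , Equivalence.from e)) }

  ∃ⁿ : ∀ q {p} → Formula (q + p) → Formula p
  ∃ⁿ zero    φ = φ
  ∃ⁿ (suc q) φ = ∃ⁿ q (∃f φ)

  Sat-∃ⁿ : ∀ q {p} (φ : Formula (q + p)) (v : Vec M p) → Sat (∃ⁿ q φ) v ⇔ Σ (Vec M q) λ w → Sat φ (w ++ v)
  Sat-∃ⁿ zero    φ v = mk⇔ ([] ,_) (λ { ([] , h) → h })
  Sat-∃ⁿ (suc q) φ v = ⇔-trans (Sat-∃ⁿ q (∃f φ) v)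
    (mk⇔ (λ (w , m , h) → m ∷ w , h) (λ { (m ∷ w , h) → w , m , h }))

  ∀ⁿ : ∀ q {p} → Formula (q + p) → Formula p
  ∀ⁿ zero    φ = φ
  ∀ⁿ (suc q) φ = ∀ⁿ q (∀f φ)

  Sat-∀ⁿ : ∀ q {p} (φ : Formula (q + p)) (v : Vec M p) → Sat (∀ⁿ q φ) v ⇔ ((w : Vec M q) → Sat φ (w ++ v))
  Sat-∀ⁿ zero    φ v = mk⇔ (λ { h [] → h }) (λ h → h [])
  Sat-∀ⁿ (suc q) φ v = ⇔-trans (Sat-∀ⁿ q (∀f φ) v)
    (mk⇔ (λ { h (m ∷ w) → h w m }) (λ h w m → h (m ∷ w)))

  -- The quantified block comes first, as ∃f and ∀f bind variable zero.
  module _ {p q : ℕ} {P : Vec M p → Vec M q → Set} (D : IsDefinable (λ u → P (drop q u) (take q u))) where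

    private
      defines-++ : ∀ w v → Sat (formula D) (w ++ v) ⇔ P v w
      defines-++ w v = ⇔-trans (defines D (w ++ v)) (≡⇒⇔ (cong₂ P (drop-++ w v) (take-++ w v)))

    ∃-isDefinable : IsDefinable (λ v → Σ (Vec M q) (P v))
    ∃-isDefinable = record
      { formula = ∃ⁿ q (formula D)
      ; defines = λ v → ⇔-trans (Sat-∃ⁿ q (formula D) v) (Σ-⇔ (↠-id _) (defines-++ _ v)) }

    ∀-isDefinable : IsDefinable (λ v → (w : Vec M q) → P v w)
    ∀-isDefinable = record
      { formula = ∀ⁿ q (formula D)
      ; defines = λ v → ⇔-trans (Sat-∀ⁿ q (formula D) v) (Π-⇔ (λ w → defines-++ w v)) }

module Boxes {L : Language} (𝓜 : Structure L) where
  open Semantics 𝓜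

  module _ {p q : ℕ} {S : Vec M p → Set} {T : Vec M q → Set} where

    ∈Box-++ : (β : Box S T) {x : Vec M p} {w : Vec M q} → (x ++ w) ∈Box β ⇔ (x ∈ Box.U β × w ∈ Box.V β)
    ∈Box-++ β {x} {w} = ≡⇒⇔ (cong₂ (λ x′ w′ → x′ ∈ Box.U β × w′ ∈ Box.V β) (take-++ x w) (drop-++ x w))

    ∈Box-++-mono : (β : Box S T) {x x′ : Vec M p} {w w′ : Vec M q} →
                   (x ∈ Box.U β → x′ ∈ Box.U β) → (w ∈ Box.V β → w′ ∈ Box.V β) →
                   (x ++ w) ∈Box β → (x′ ++ w′) ∈Box β
    ∈Box-++-mono β f g h =
      let (hx , hw) = Equivalence.to (∈Box-++ β) h in Equivalence.from (∈Box-++ β) (f hx , g hw)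

    unionOfBoxes-transfer : {F : Definable (p + q)} ((bs , _) : FiniteUnionOfBoxes S T F) {v v′ : Vec M (p + q)} →
                            All (λ β → v ∈Box β → v′ ∈Box β) bs → v ∈ F → v′ ∈ F
    unionOfBoxes-transfer (_ , F⇔) {v} {v′} fs h =
      Equivalence.from (F⇔ v′) (Any-mp fs (Equivalence.to (F⇔ v) h))

  BoxDecomposable-subst : ∀ {p p′ q} {S : Vec M p → Set} {T : Vec M q → Set} (e : p ≡ p′) →
                          BoxDecomposable S T → BoxDecomposable (subst (λ k → Vec M k → Set) e S) T
  BoxDecomposable-subst refl h = h

module Powers {L : Language} (𝓜 : Structure L) {a : ℕ} (X : Semantics.Definable 𝓜 a) where
  open Semantics 𝓜

  InPow-suc : ∀ {p} {x : Vec M a} {u : Vec M (p * a)} → x ∈ X → InPow X p u → InPow X (suc p) (x ++ u)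
  InPow-suc {p} {x} {u} hx hu = subst (_∈ X) (sym (take-++ x u)) hx , subst (InPow X p) (sym (drop-++ x u)) hu

  InPow-++ : ∀ p q (u : Vec M (p * a)) (u′ : Vec M (q * a)) → InPow X p u → InPow X q u′ →
             InPow X (p + q) (cast (sym (*-distribʳ-+ a p q)) (u ++ u′))
  InPow-++ zero    q [] u′ _         h′ = subst (InPow X q) (sym (cast-is-id _ u′)) h′
  InPow-++ (suc p) q u  u′ (hx , hu) h′ =
    subst (InPow X (suc p + q)) (sym split) (InPow-suc hx (InPow-++ p q (drop a u) u′ hu h′))
    where
      split : cast (sym (*-distribʳ-+ a (suc p) q)) (u ++ u′)
              ≡ take a u ++ cast (sym (*-distribʳ-+ a p q)) (drop a u ++ u′)
      split = trans (cong (λ t → cast (sym (*-distribʳ-+ a (suc p) q)) (t ++ u′)) (sym (take++drop≡id a u)))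
                    (cast-++-assoc (take a u) (drop a u) u′ _ _)

module Classical (em : ExcludedMiddle 0ℓ) where

  representatives : {T : Set} (Ps : List (T → Set)) (Q : T → Set) →
                    Σ (List T) λ ts → ∀ t → Q t → Any (λ t′ → Q t′ × All (λ P → P t′ → P t) Ps) ts
  representatives {T} [] Q with em {Σ T Q}
  ... | yes (t₀ , q₀) = t₀ ∷ [] , λ _ _ → here (q₀ , [])
  ... | no ∄t         = [] , λ t q → ⊥-elim (∄t (t , q))
  representatives (P ∷ Ps) Q = proj₁ reps¬P ++ᴸ proj₁ repsP , covers
    where
      reps¬P = representatives Ps (λ t → Q t × ¬ P t)
      repsP  = representatives Ps (λ t → Q t × P t)
      covers : ∀ t → Q t → _
      covers t q with em {P t}
      ... | yes pt = Anyₚ.++⁺ʳ (proj₁ reps¬P)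
                       (Any.map (λ ((q′ , _) , fs) → q′ , (λ _ → pt) ∷ fs) (proj₂ repsP t (q , pt)))
      ... | no ¬pt = Anyₚ.++⁺ˡ
                       (Any.map (λ ((q′ , ¬pt′) , fs) → q′ , (λ pt′ → ⊥-elim (¬pt′ pt′)) ∷ fs)
                                (proj₂ reps¬P t (q , ¬pt)))

  module Atoms {L : Language} (𝓜 : Structure L) where
    open Semantics 𝓜

    _⊑[_]_ : ∀ {k} → Vec M k → List (Formula k) → Vec M k → Set
    x ⊑[ Us ] x′ = All (λ U → x ∈ U → x′ ∈ U) Us

    Homogeneous : ∀ {k} → List (Formula k) → Formula k → Set
    Homogeneous Us A = ∀ {x x′} → x ∈ A → x′ ∈ A → x ⊑[ Us ] x′

    atoms : ∀ {k} (Us : List (Formula k)) →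
            Σ (List (Formula k)) λ As → (∀ x → Any (x ∈_) As) × All (Homogeneous Us) As
    atoms []       = ⊤f ∷ [] , (λ _ → here tt) , ((λ _ _ → []) ∷ [])
    atoms (U ∷ Us) = mapᴸ (_∧f U) As ++ᴸ mapᴸ (λ A → A ∧f (¬f U)) As , covers , homogeneous
      where
        As           = proj₁ (atoms Us)
        covers′      = proj₁ (proj₂ (atoms Us))
        homogeneous′ = proj₂ (proj₂ (atoms Us))
        covers : ∀ x → Any (x ∈_) (mapᴸ (_∧f U) As ++ᴸ mapᴸ (λ A → A ∧f (¬f U)) As)
        covers x with em {x ∈ U}
        ... | yes u = Anyₚ.++⁺ˡ (Anyₚ.map⁺ (Any.map (_, u) (covers′ x)))
        ... | no ¬u = Anyₚ.++⁺ʳ _ (Anyₚ.map⁺ (Any.map (_, ¬u) (covers′ x)))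
        homogeneous : All (Homogeneous (U ∷ Us)) (mapᴸ (_∧f U) As ++ᴸ mapᴸ (λ A → A ∧f (¬f U)) As)
        homogeneous = Allₚ.++⁺
          (Allₚ.map⁺ (All.map (λ h {_} {_} (a , _) (a′ , u′) → (λ _ → u′) ∷ h a a′) homogeneous′))
          (Allₚ.map⁺ (All.map (λ h {_} {_} (a , ¬u) (a′ , _) → (λ u → ⊥-elim (¬u u)) ∷ h a a′) homogeneous′))

module BoxDecomposition (em : ExcludedMiddle 0ℓ) {L : Language} (𝓜 : Structure L) where
  open Semantics 𝓜
  open Definability 𝓜
  open IsDefinable
  open Boxes 𝓜
  open Classical em
  open Atoms 𝓜

  module _ {a b c : ℕ} (X : Definable a) (Y : Definable b) (Z : Definable c)
           (decomposeY : (n : ℕ) → BoxDecomposable (InPow X (suc n)) (_∈ Y))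
           (decomposeZ : (n : ℕ) → BoxDecomposable (InPow X (suc n)) (_∈ Z))
           (n : ℕ) (D : Definable (suc n * a + (b + c)))
           (D⊆ : SubsetOf× (InPow X (suc n)) (_∈× (Y , Z)) D) where
    open Powers 𝓜 X

    N : ℕ
    N = suc n * a

    SX : Vec M N → Set
    SX = InPow X (suc n)

    InD : Vec M N → Vec M b → Vec M c → Set
    InD x y z = (x ++ (y ++ z)) ∈ D

    Proj : Vec M N → Set
    Proj x = Σ (Vec M (b + c)) λ w → (x ++ w) ∈ D

    Proj-isDefinable : IsDefinable Proj
    Proj-isDefinable = ∃-isDefinable {P = λ x w → (x ++ w) ∈ D}
                         (∘-isDefinable (dropᵐ (b + c) ++ᵐ takeᵐ (b + c)) (∈-isDefinable D))

    Proj⊆SX : ∀ {x} → Proj x → SX x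
    Proj⊆SX {x} (w , h) = subst SX (take-++ x w) (proj₁ (D⊆ (x ++ w) h))

    fibre-isDefinable : (y : Vec M b) → IsDefinable (λ u → InD (take N u) y (drop N u))
    fibre-isDefinable y = ∘-isDefinable (takeᵐ N ++ᵐ constᵐ y ++ᵐ dropᵐ N) (∈-isDefinable D)

    fibre : Vec M b → Formula (N + c)
    fibre y = formula (fibre-isDefinable y)

    fibre-sat : ∀ y x z → (x ++ z) ∈ fibre y ⇔ InD x y z
    fibre-sat y x z = ⇔-trans (defines (fibre-isDefinable y) (x ++ z))
                        (≡⇒⇔ (cong₂ (λ x′ z′ → InD x′ y z′) (take-++ x z) (drop-++ x z)))

    fibre⊆ : ∀ y → SubsetOf× SX (_∈ Z) (fibre y)
    fibre⊆ y u h =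
      let (hx , hw) = D⊆ _ (Equivalence.to (defines (fibre-isDefinable y) u) h) in
      subst SX (take-++ (take N u) _) hx ,
      subst (_∈ Z) (drop-++ y (drop N u))
        (proj₂ (subst (_∈× (Y , Z)) (drop-++ (take N u) (y ++ drop N u)) hw))

    fibre-decomposition : ∀ y → FiniteUnionOfBoxes SX (_∈ Z) (fibre y)
    fibre-decomposition y = decomposeZ n (fibre y) (fibre⊆ y)

    fibreComponents : Vec M b → List (Formula N)
    fibreComponents y = mapᴸ Box.U (proj₁ (fibre-decomposition y))

    SameFibre : Vec M N → Vec M N → Vec M b → Set
    SameFibre x x′ y = ∀ z → InD x y z ⇔ InD x′ y z

    fibre-transfer : ∀ {x x′} y → x ⊑[ fibreComponents y ] x′ → ∀ z → InD x y z → InD x′ y z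
    fibre-transfer {x} {x′} y x⊑x′ z h =
      Equivalence.to (fibre-sat y x′ z)
        (unionOfBoxes-transfer {F = fibre y} (fibre-decomposition y)
          (All.map (λ {β} f → ∈Box-++-mono β f (λ h → h)) (Allₚ.map⁻ x⊑x′))
          (Equivalence.from (fibre-sat y x z) h))

    Related : Vec M N → Vec M N → Vec M b → Set
    Related x x′ y = (Proj x × Proj x′) × (y ∈ Y × SameFibre x x′ y)

    Related-isDefinable :
      IsDefinable (λ v → Related (take N (take (N + N) v)) (drop N (take (N + N) v)) (drop (N + N) v))
    Related-isDefinable =
      ×-isDefinable (×-isDefinable (∘-isDefinable (takeᵐ N ∘ᵐ takeᵐ (N + N)) Proj-isDefinable)
                                   (∘-isDefinable (dropᵐ N ∘ᵐ takeᵐ (N + N)) Proj-isDefinable))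
                    (×-isDefinable (∘-isDefinable (dropᵐ (N + N)) (∈-isDefinable Y))
                                   (∀-isDefinable (⇔-isDefinable (D-along (takeᵐ N)) (D-along (dropᵐ N)))))
      where
        D-along : ∀ {f} → DefinableMap (N + N) N f →
                  IsDefinable (λ u → (f (take (N + N) (drop c u)) ++ (drop (N + N) (drop c u) ++ take c u)) ∈ D)
        D-along F = ∘-isDefinable ((F ∘ᵐ takeᵐ (N + N) ∘ᵐ dropᵐ c) ++ᵐ (dropᵐ (N + N) ∘ᵐ dropᵐ c) ++ᵐ takeᵐ c)
                                  (∈-isDefinable D)

    E : Formula ((N + N) + b)
    E = formula Related-isDefinable

    E-sat : ∀ x x′ y → ((x ++ x′) ++ y) ∈ E ⇔ Related x x′ y
    E-sat x x′ y = ⇔-trans (defines Related-isDefinable ((x ++ x′) ++ y)) (≡⇒⇔ unfold)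
      where
        unfold : Related (take N (take (N + N) ((x ++ x′) ++ y))) (drop N (take (N + N) ((x ++ x′) ++ y)))
                         (drop (N + N) ((x ++ x′) ++ y))
                 ≡ Related x x′ y
        unfold rewrite take-++ (x ++ x′) y | drop-++ (x ++ x′) y | take-++ x x′ | drop-++ x x′ = refl

    -- X^(2n+2) on M^(N + N): the arities (2n+2)·a and N + N agree only propositionally.
    SX² : Vec M (N + N) → Set
    SX² = subst (λ k → Vec M k → Set) (*-distribʳ-+ a (suc n) (suc n)) (InPow X (suc n + suc n))

    E⊆ : SubsetOf× SX² (_∈ Y) E
    E⊆ v h =
      let ((px , px′) , y∈Y , _) = Equivalence.to (defines Related-isDefinable v) h in
      subst-pred (*-distribʳ-+ a (suc n) (suc n)) (InPow X (suc n + suc n)) (take (N + N) v)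
        (subst (InPow X (suc n + suc n) ∘ cast (sym (*-distribʳ-+ a (suc n) (suc n))))
               (take++drop≡id N (take (N + N) v))
               (InPow-++ (suc n) (suc n) _ _ (Proj⊆SX px) (Proj⊆SX px′))) ,
      y∈Y

    E-decomposition : FiniteUnionOfBoxes SX² (_∈ Y) E
    E-decomposition = BoxDecomposable-subst (*-distribʳ-+ a (suc n) (suc n)) (decomposeY (n + suc n)) E E⊆

    Related-transfer : ∀ {x x′ y y′} → All (λ γ → y′ ∈ Box.V γ → y ∈ Box.V γ) (proj₁ E-decomposition) →
                       Related x x′ y′ → Related x x′ y
    Related-transfer {x} {x′} {y} {y′} V-mono r =
      Equivalence.to (E-sat x x′ y)
        (unionOfBoxes-transfer {F = E} E-decomposition
          (All.map (λ {γ} g → ∈Box-++-mono γ (λ h → h) g) V-mono)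
          (Equivalence.from (E-sat x x′ y′) r))

    E-ySides : List (Vec M b → Set)
    E-ySides = mapᴸ (λ γ y → y ∈ Box.V γ) (proj₁ E-decomposition)

    Y-representatives : Σ (List (Vec M b)) λ ys → ∀ y → y ∈ Y →
                          Any (λ y′ → y′ ∈ Y × All (λ P → P y′ → P y) E-ySides) ys
    Y-representatives = representatives E-ySides (_∈ Y)

    components : List (Formula N)
    components = concatMap fibreComponents (proj₁ Y-representatives)

    D-transfer : ∀ {x x′} → Proj x → Proj x′ → x ⊑[ components ] x′ → x′ ⊑[ components ] x →
                 ∀ w → (x ++ w) ∈ D → (x′ ++ w) ∈ D
    D-transfer {x} {x′} px px′ x⊑x′ x′⊑x w h =
      -- E(x, x′, y′) for the representative y′ of y, and E(x, x′, y) follows.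
      let ((x⊑ᵧx′ , x′⊑ᵧx) , y′∈Y , V-mono) = All.lookupAny agree (proj₂ Y-representatives y y∈Y)
          same = proj₂ (proj₂ (Related-transfer (Allₚ.map⁻ V-mono)
                   ((px , px′) , y′∈Y , λ z → mk⇔ (fibre-transfer _ x⊑ᵧx′ z) (fibre-transfer _ x′⊑ᵧx z))))
      in subst (λ w → (x′ ++ w) ∈ D) w≡ (Equivalence.to (same z) (subst (λ w → (x ++ w) ∈ D) (sym w≡) h))
      where
        y = take b w
        z = drop b w
        w≡ = take++drop≡id b w
        y∈Y = proj₁ (subst (_∈× (Y , Z)) (drop-++ x w) (proj₂ (D⊆ (x ++ w) h)))
        agree : All (λ y′ → x ⊑[ fibreComponents y′ ] x′ × x′ ⊑[ fibreComponents y′ ] x)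
                    (proj₁ Y-representatives)
        agree = All.zip (Allₚ.map⁻ (Allₚ.concat⁻ x⊑x′) , Allₚ.map⁻ (Allₚ.concat⁻ x′⊑x))

    atomFibre-isDefinable : (A : Formula N) → IsDefinable (λ w → Σ (Vec M N) λ x → x ∈ A × (x ++ w) ∈ D)
    atomFibre-isDefinable A = ∃-isDefinable {P = λ w x → x ∈ A × (x ++ w) ∈ D}
      (×-isDefinable (∘-isDefinable (takeᵐ N) (∈-isDefinable A))
                     (∘-isDefinable (takeᵐ N ++ᵐ dropᵐ N) (∈-isDefinable D)))

    atomBox : Formula N → Box SX (_∈× (Y , Z))
    atomBox A = record
      { U   = A ∧f formula Proj-isDefinable
      ; V   = formula (atomFibre-isDefinable A)
      ; U⊆S = λ x (_ , h) → Proj⊆SX (Equivalence.to (defines Proj-isDefinable x) h)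
      ; V⊆T = λ w h → let (x , _ , d) = Equivalence.to (defines (atomFibre-isDefinable A) w) h in
                      subst (_∈× (Y , Z)) (drop-++ x w) (proj₂ (D⊆ (x ++ w) d)) }

    decomposition : FiniteUnionOfBoxes SX (_∈× (Y , Z)) D
    decomposition = mapᴸ atomBox As , λ v → mk⇔ (covered v) (sound v)
      where
        As = proj₁ (atoms components)
        covered : ∀ v → v ∈ D → Any (v ∈Box_) (mapᴸ atomBox As)
        covered v h =
          Anyₚ.map⁺ (Any.map (λ {A} x∈A → (x∈A , Equivalence.from (defines Proj-isDefinable x) (w , h′)) ,
                                          Equivalence.from (defines (atomFibre-isDefinable A) w) (x , x∈A , h′))
                            (proj₁ (proj₂ (atoms components)) x))
          where
            x = take N v
            w = drop N v
            h′ = subst (_∈ D) (sym (take++drop≡id N v)) h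
        sound : ∀ v → Any (v ∈Box_) (mapᴸ atomBox As) → v ∈ D
        sound v hb =
          let (homogeneous , (x∈A , x∈π) , w∈V) =
                All.lookupAny (proj₂ (proj₂ (atoms components))) (Anyₚ.map⁻ hb)
              (x′ , x′∈A , d′) = Equivalence.to (defines (atomFibre-isDefinable _) (drop N v)) w∈V
              px = Equivalence.to (defines Proj-isDefinable _) x∈π
          in subst (_∈ D) (take++drop≡id N v)
               (D-transfer (drop N v , d′) px (homogeneous x′∈A x∈A) (homogeneous x∈A x′∈A) (drop N v) d′)

proposition2p5 : ExcludedMiddle 0ℓ →
    {L : Language} (𝓜 : Structure L) →
    let open Semantics 𝓜 in
    {a b c : ℕ} (X : Definable a) (Y : Definable b) (Z : Definable c) →
    ((n : ℕ) → BoxDecomposable (InPow X (suc n)) (_∈ Y)) →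
    ((n : ℕ) → BoxDecomposable (InPow X (suc n)) (_∈ Z)) →
    (n : ℕ) → BoxDecomposable (InPow X (suc n)) (λ w → w ∈× (Y , Z))
proposition2p5 em 𝓜 X Y Z decomposeY decomposeZ n D D⊆ =
  BoxDecomposition.decomposition em 𝓜 X Y Z decomposeY decomposeZ n D D⊆
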